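{- Let $k,\tau\ge0$ be integers. Then there exists an integer $K\ge0$ with the following property. Let $\mathcal P$ be a parade of length $(K,K)$ in a bigraph $G$, and let $0<\lambda\le1$. Then $\mathcal P$ has a sub-parade of length $(k,k)$ which is $\tau$-support-uniform.
   Context: A bigraph $G$ is a finite simple graph with a designated bipartition $(V_1(G),V_2(G))$, all edges between the parts; isomorphisms of bigraphs map $V_i$ onto $V_i$. A tree bigraph is a bigraph whose underlying graph is a tree. A parade in $G$ is a sequence $\mathcal P=(A_1,\dots,A_K;B_1,\dots,B_L)$ of pairwise disjoint nonempty subsets of $V(G)$ with $A_i\subseteq V_1(G)$, $B_j\subseteq V_2(G)$, all $A_i$ of equal cardinality and all $B_j$ of equal cardinality; its length is $(K,L)$ and the $A_i,B_j$ are its blocks. A sub-parade is $(A_{r_1},\dots,A_{r_k};B_{s_1},\dots,B_{s_\ell})$ for some $1\le r_1<\dots<r_k\le K$, $1\le s_1<\dots<s_\ell\le L$. An induced sub-bigraph $H$ of $G$ is $\mathcal P$-rainbow if each vertex lies in some block and no two in the same block; its support is $(I,J)$ with $I=\{i:V(H)\cap A_i\ne\emptyset\}$, $J=\{j:V(H)\cap B_j\neq\emptyset\}$ (indices relative to the parade). An ordered bigraph is a bigraph with linear orders on $V_1$ and $V_2$ (isomorphisms preserve them); a $\mathcal P$-rainbow $H$ is ordered by block index, and is a $\mathcal P$-rainbow copy of an ordered bigraph $S$ if this ordered bigraph is isomorphic to $S$. The trace of $S$ relative to $\mathcal P$ is the set of supports of all $\mathcal P$-rainbow copies of $S$. $\mathcal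 P$ is $\tau$-support-uniform if for every ordered tree bigraph $S$ with at most $\tau$ vertices, the trace of $S$ is either empty or the set of all $(I,J)$ with $I\subseteq\{1,\dots,K\}$, $J\subseteq\{1,\dots,L\}$, $|I|=|V_1(S)|$, $|J|=|V_2(S)|$. -}

module Defs where

open import Data.Nat as ℕ using (ℕ; _+_; _≤_)
open import Data.Fin as Fin using (Fin)
open import Data.Fin.Subset using (Subset; _∈_; ∣_∣; Nonempty)
open import Data.Bool using (Bool; true)
open import Data.Sum using (_⊎_; inj₁; inj₂)
open import Data.Product using (Σ; ∃; _×_; _,_)
open import Data.List using (List; []; _∷_; _++_; length)
open import Data.List.Relation.Unary.Unique.Propositional using (Unique)
open import Data.List.Relation.Unary.Linked using (Linked)
open import Data.Empty using (⊥)
open import Relation.Nullary using (¬_)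
open import Relation.Binary.PropositionalEquality using (_≡_; _≢_)
open import Function.Bundles using (_⇔_)

record Bigraph (n₁ n₂ : ℕ) : Set where
  field
    edge : Fin n₁ → Fin n₂ → Bool
open Bigraph public

Vertex : ℕ → ℕ → Set
Vertex n₁ n₂ = Fin n₁ ⊎ Fin n₂

Adj : ∀ {n₁ n₂} → Bigraph n₁ n₂ → Vertex n₁ n₂ → Vertex n₁ n₂ → Set
Adj G (inj₁ a) (inj₂ b) = edge G a b ≡ true
Adj G (inj₂ b) (inj₁ a) = edge G a b ≡ true
Adj G (inj₁ _) (inj₁ _) = ⊥
Adj G (inj₂ _) (inj₂ _) = ⊥

data Walk {n₁ n₂} (G : Bigraph n₁ n₂) : Vertex n₁ n₂ → Vertex n₁ n₂ → Set where
  here : ∀ {u} → Walk G u u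
  step : ∀ {u v w} → Adj G u v → Walk G v w → Walk G u w

Connected : ∀ {n₁ n₂} → Bigraph n₁ n₂ → Set
Connected G = ∀ u w → Walk G u w

HasCycle : ∀ {n₁ n₂} → Bigraph n₁ n₂ → Set
HasCycle {n₁} {n₂} G =
  Σ (Vertex n₁ n₂) λ v → Σ (List (Vertex n₁ n₂)) λ vs →
    (2 ≤ length vs) × Unique (v ∷ vs) × Linked (Adj G) (v ∷ vs ++ (v ∷ []))

IsTree : ∀ {n₁ n₂} → Bigraph n₁ n₂ → Set
IsTree {n₁} {n₂} G = (1 ≤ n₁ + n₂) × Connected G × ¬ HasCycle G

record IsParade {n₁ n₂ K L : ℕ} (A : Fin K → Subset n₁) (B : Fin L → Subset n₂) : Set where
  field
    A-nonempty : ∀ i → Nonempty (A i)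
    B-nonempty : ∀ j → Nonempty (B j)
    A-disjoint : ∀ i i′ → i ≢ i′ → ∀ x → x ∈ A i → x ∈ A i′ → ⊥
    B-disjoint : ∀ j j′ → j ≢ j′ → ∀ y → y ∈ B j → y ∈ B j′ → ⊥
    A-equal    : ∀ i i′ → ∣ A i ∣ ≡ ∣ A i′ ∣
    B-equal    : ∀ j j′ → ∣ B j ∣ ≡ ∣ B j′ ∣
    -- (blocks of A and B are automatically disjoint, as V₁ ∩ V₂ = ∅)

StrictlyIncreasing : ∀ {m n} → (Fin m → Fin n) → Set
StrictlyIncreasing {m} r = ∀ (i j : Fin m) → i Fin.< j → r i Fin.< r j

-- Ordered bigraphs: V₁ = Fin p, V₂ = Fin q with their natural orders.
-- A P-rainbow copy of an ordered bigraph S (with V₁(S) = Fin p,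
-- V₂(S) = Fin q): the i-th vertex of V₁(S) goes to a vertex f a lying in
-- block A (ι a), with ι strictly increasing (so distinct blocks, and the
-- block-index order agrees with the order of S), similarly for V₂; and
-- adjacency is preserved and reflected (induced copy).

record RainbowCopy {n₁ n₂ K L p q : ℕ} (G : Bigraph n₁ n₂)
                   (A : Fin K → Subset n₁) (B : Fin L → Subset n₂)
                   (S : Bigraph p q) : Set where
  field
    ι     : Fin p → Fin K
    κ     : Fin q → Fin L
    ι-inc : StrictlyIncreasing ι
    κ-inc : StrictlyIncreasing κ
    f     : Fin p → Fin n₁
    g     : Fin q → Fin n₂
    f∈    : ∀ a → f a ∈ A (ι a)
    g∈    : ∀ b → g b ∈ B (κ b)
    adj   : ∀ a b → edge G (f a) (g b) ≡ edge S a b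

IsImage : ∀ {m n} → (Fin m → Fin n) → Subset n → Set
IsImage {m} {n} ι I = ∀ (x : Fin n) → x ∈ I ⇔ (∃ λ (a : Fin m) → ι a ≡ x)

InTrace : ∀ {n₁ n₂ K L p q : ℕ} (G : Bigraph n₁ n₂)
          (A : Fin K → Subset n₁) (B : Fin L → Subset n₂)
          (S : Bigraph p q) → Subset K → Subset L → Set
InTrace G A B S I J =
  Σ (RainbowCopy G A B S) λ c → IsImage (RainbowCopy.ι c) I × IsImage (RainbowCopy.κ c) J

SupportUniform : ∀ {n₁ n₂ K L : ℕ} (τ : ℕ) (G : Bigraph n₁ n₂)
                 (A : Fin K → Subset n₁) (B : Fin L → Subset n₂) → Set
SupportUniform {K = K} {L = L} τ G A B =
  ∀ (p q : ℕ) (S : Bigraph p q) → IsTree S → p + q ≤ τ →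
    (∀ (I : Subset K) (J : Subset L) → ¬ InTrace G A B S I J)
    ⊎ (∀ (I : Subset K) (J : Subset L) → InTrace G A B S I J ⇔ (∣ I ∣ ≡ p × ∣ J ∣ ≡ q))

-- For every ordered bigraph S with p + q ≤ τ, colour each increasing
-- (p + q)-tuple of block indices by whether G has a rainbow copy of S whose
-- V₁-vertices lie in the A-blocks of the first p indices and whose V₂-vertices
-- lie in the B-blocks of the last q. There are finitely many such S, so
-- iterating Ramsey's theorem yields 2k indices on which all these colourings
-- are constant. Take the first k as A-blocks and the last k as B-blocks: any
-- supports I, J then concatenate to an increasing tuple of the 2k indices, so
-- whether S has a copy with support (I , J) does not depend on (I , J).
--
-- Ramsey's theorem for increasing m-tuples is proved by induction on m: pass to
-- a subsequence on which the colour of a tuple depends only on its least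
-- element, then apply the pigeonhole principle to that element.

{-# OPTIONS --safe #-}
module Submission where

open import Defs
open import Data.Bool using (Bool; true; false)
open import Data.Bool.Properties using () renaming (_≟_ to _≟ᵇ_)
open import Data.Fin using (Fin; zero; suc; toℕ; _↑ˡ_; _↑ʳ_; splitAt; inject≤; punchOut; _<_)
open import Data.Fin.Properties as Finₚ using (toℕ-↑ˡ; toℕ-↑ʳ; toℕ<n; toℕ-inject≤; any?; all?)
open import Data.Fin.Subset as Sub using (Subset; ∣_∣)
open import Data.Fin.Subset.Properties using (_∈?_)
open import Data.List as List
  using (List; []; _∷_; concatMap; cartesianProduct; cartesianProductWith; upTo)
open import Data.List.Membership.Propositional using (_∈_)
open import Data.List.Membership.Propositional.Properties
  using (∈-map⁺; ∈-concat⁺′; ∈-cartesianProduct⁺; ∈-cartesianProductWith⁺; ∈-upTo⁺)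
open import Data.List.Relation.Unary.Any using (here; there)
open import Data.Nat as ℕ using (ℕ; zero; suc; _+_; _≤_; s≤s; z<s; s<s⁻¹)
open import Data.Nat.Properties as ℕₚ using ()
open import Data.Product using (Σ; ∃; _×_; _,_; proj₁; proj₂; uncurry)
open import Data.Sum as Sum using (_⊎_; inj₁; inj₂)
open import Data.Vec as Vec using (Vec; lookup; tabulate)
open import Data.Vec.Base using (here; there)
open import Data.Vec.Properties using (lookup∘tabulate)
open import Data.Vec.Functional as Vector using (_++_)
open import Data.Vec.Functional.Properties using (∷-cong; lookup-++ˡ; lookup-++ʳ)
open import Function using (_∘_; id)
open import Function.Bundles using (_⇔_; mk⇔; Equivalence)
open import Relation.Binary using (tri<; tri≈; tri>)
open import Relation.Binary.PropositionalEquality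
open import Relation.Nullary using (Dec; yes; no; does; ¬_; contradiction)
open import Relation.Nullary.Decidable using (_×-dec_; map′; dec-true; does-⇔)

∃Increasing : (k n : ℕ) → ((Fin k → Fin n) → Set) → Set
∃Increasing k n P = Σ (Fin k → Fin n) λ h → StrictlyIncreasing h × P h

id-increasing : ∀ {n} → StrictlyIncreasing (id {A = Fin n})
id-increasing _ _ i<j = i<j

∘-increasing : ∀ {a b c} {f : Fin b → Fin c} {g : Fin a → Fin b} →
               StrictlyIncreasing f → StrictlyIncreasing g → StrictlyIncreasing (f ∘ g)
∘-increasing f-inc g-inc i j i<j = f-inc _ _ (g-inc i j i<j)

suc-increasing : ∀ {n} → StrictlyIncreasing (suc {n})
suc-increasing _ _ = ℕ.s<s

∷-increasing : ∀ {m n} {x : Fin n} {f : Fin m → Fin n} →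
               (∀ j → x < f j) → StrictlyIncreasing f → StrictlyIncreasing (x Vector.∷ f)
∷-increasing x<f f-inc zero    (suc j) _   = x<f j
∷-increasing x<f f-inc (suc i) (suc j) i<j = f-inc i j (s<s⁻¹ i<j)

0∷suc-increasing : ∀ {m n} {f : Fin m → Fin n} →
                   StrictlyIncreasing f → StrictlyIncreasing (zero Vector.∷ suc ∘ f)
0∷suc-increasing f-inc = ∷-increasing (λ _ → z<s) (∘-increasing suc-increasing f-inc)

↑ˡ-increasing : ∀ {m} n → StrictlyIncreasing (λ (i : Fin m) → i ↑ˡ n)
↑ˡ-increasing n i j = subst₂ ℕ._<_ (sym (toℕ-↑ˡ i n)) (sym (toℕ-↑ˡ j n))

↑ˡ-cancel-< : ∀ {m} n {i j : Fin m} → i ↑ˡ n < j ↑ˡ n → i < j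
↑ˡ-cancel-< n {i} {j} = subst₂ ℕ._<_ (toℕ-↑ˡ i n) (toℕ-↑ˡ j n)

↑ʳ-increasing : ∀ m {n} → StrictlyIncreasing (λ (j : Fin n) → m ↑ʳ j)
↑ʳ-increasing m i j i<j =
  subst₂ ℕ._<_ (sym (toℕ-↑ʳ m i)) (sym (toℕ-↑ʳ m j)) (ℕₚ.+-monoʳ-< m i<j)

↑ʳ-cancel-< : ∀ m {n} {i j : Fin n} → m ↑ʳ i < m ↑ʳ j → i < j
↑ʳ-cancel-< m {i = i} {j} = ℕₚ.+-cancelˡ-< m _ _ ∘ subst₂ ℕ._<_ (toℕ-↑ʳ m i) (toℕ-↑ʳ m j)

↑ˡ<↑ʳ : ∀ {m n} (i : Fin m) (j : Fin n) → i ↑ˡ n < m ↑ʳ j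
↑ˡ<↑ʳ {m} {n} i j = subst₂ ℕ._<_ (sym (toℕ-↑ˡ i n)) (sym (toℕ-↑ʳ m j))
  (ℕₚ.<-≤-trans (toℕ<n i) (ℕₚ.m≤m+n m (toℕ j)))

inject≤-increasing : ∀ {m n} (m≤n : m ≤ n) → StrictlyIncreasing (λ (i : Fin m) → inject≤ i m≤n)
inject≤-increasing m≤n i j = subst₂ ℕ._<_ (sym (toℕ-inject≤ i m≤n)) (sym (toℕ-inject≤ j m≤n))

data SplitView (m n : ℕ) : Fin (m + n) → Set where
  left  : (i : Fin m) → SplitView m n (i ↑ˡ n)
  right : (j : Fin n) → SplitView m n (m ↑ʳ j)

splitView : ∀ m n (x : Fin (m + n)) → SplitView m n x
splitView m n x with splitAt m x in eq
... | inj₁ i = subst (SplitView m n) (Finₚ.splitAt⁻¹-↑ˡ eq) (left i)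
... | inj₂ j = subst (SplitView m n) (Finₚ.splitAt⁻¹-↑ʳ eq) (right j)

++-increasing : ∀ {m n o} {f : Fin m → Fin o} {g : Fin n → Fin o} →
                StrictlyIncreasing f → StrictlyIncreasing g → (∀ i j → f i < g j) →
                StrictlyIncreasing (f ++ g)
++-increasing {m} {n} {f = f} {g} f-inc g-inc f<g x y = compare (splitView m n x) (splitView m n y)
  where
  compare : ∀ {x y} → SplitView m n x → SplitView m n y → x < y → (f ++ g) x < (f ++ g) y
  compare (left i)  (left j)  i<j =
    subst₂ _<_ (sym (lookup-++ˡ f g i)) (sym (lookup-++ˡ f g j)) (f-inc i j (↑ˡ-cancel-< n i<j))
  compare (left i)  (right j) _   =
    subst₂ _<_ (sym (lookup-++ˡ f g i)) (sym (lookup-++ʳ f g j)) (f<g i j)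
  compare (right i) (left j)  i>j = contradiction i>j (Finₚ.<-asym (↑ˡ<↑ʳ j i))
  compare (right i) (right j) i<j =
    subst₂ _<_ (sym (lookup-++ʳ f g i)) (sym (lookup-++ʳ f g j)) (g-inc i j (↑ʳ-cancel-< m i<j))

increasing⇒injective : ∀ {m n} {f : Fin m → Fin n} → StrictlyIncreasing f →
                       ∀ {i j} → f i ≡ f j → i ≡ j
increasing⇒injective f-inc {i} {j} fi≡fj with Finₚ.<-cmp i j
... | tri< i<j _ _ = contradiction fi≡fj (Finₚ.<⇒≢ (f-inc i j i<j))
... | tri≈ _ i≡j _ = i≡j
... | tri> _ _ j<i = contradiction (sym fi≡fj) (Finₚ.<⇒≢ (f-inc j i j<i))

increasing⇒≤ : ∀ {m n} {f : Fin m → Fin n} → StrictlyIncreasing f → m ≤ n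
increasing⇒≤ f-inc = Finₚ.injective⇒≤ (increasing⇒injective f-inc)

strip-suc : ∀ {m n} {u : Fin m → Fin (suc n)} → StrictlyIncreasing u → (∀ i → u i ≢ zero) →
            ∃Increasing m n (λ u′ → u ≗ suc ∘ u′)
strip-suc {m} {n} {u} u-inc u≢0 = u′ , u′-inc , u≗suc∘u′
  where
  u′ : Fin m → Fin n
  u′ i = punchOut (u≢0 i ∘ sym)
  u≗suc∘u′ : u ≗ suc ∘ u′
  u≗suc∘u′ i = sym (Finₚ.punchIn-punchOut (u≢0 i ∘ sym))
  u′-inc : StrictlyIncreasing u′
  u′-inc i j i<j = s<s⁻¹ (subst₂ _<_ (u≗suc∘u′ i) (u≗suc∘u′ j) (u-inc i j i<j))

tail≢zero : ∀ {m n} {u : Fin (suc m) → Fin (suc n)} → StrictlyIncreasing u →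
            ∀ i → u (suc i) ≢ zero
tail≢zero {u = u} u-inc i u≡0 = ℕₚ.n≮0 (subst (u zero <_) u≡0 (u-inc zero (suc i) z<s))

zero-or-suc : ∀ {m n} {u : Fin (suc m) → Fin (suc n)} → StrictlyIncreasing u →
              (u zero ≡ zero × ∃Increasing m n (λ u′ → u ∘ suc ≗ suc ∘ u′))
              ⊎ ∃Increasing (suc m) n (λ u′ → u ≗ suc ∘ u′)
zero-or-suc {u = u} u-inc with u zero in u₀
... | zero  = inj₁ (refl , strip-suc (∘-increasing u-inc suc-increasing) (tail≢zero u-inc))
... | suc _ = inj₂ (strip-suc u-inc λ
  { zero u₀≡0 → contradiction (trans (sym u₀) u₀≡0) λ ()
  ; (suc i)   → tail≢zero u-inc i })

-- Ramsey's theorem for increasing tuples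

Monochromatic : ∀ {k n} → (Fin n → Bool) → Bool → (Fin k → Fin n) → Set
Monochromatic c b g = ∀ i → c (g i) ≡ b

shift : ∀ {k n b} (c : Fin (suc n) → Bool) →
        ∃Increasing k n (Monochromatic (c ∘ suc) b) → ∃Increasing k (suc n) (Monochromatic c b)
shift c (g , g-inc , g-mono) = suc ∘ g , ∘-increasing suc-increasing g-inc , g-mono

prepend : ∀ {k n b} (c : Fin (suc n) → Bool) → c zero ≡ b →
          ∃Increasing k n (Monochromatic (c ∘ suc) b) →
          ∃Increasing (suc k) (suc n) (Monochromatic c b)
prepend c c₀≡b (g , g-inc , g-mono) =
  zero Vector.∷ suc ∘ g , 0∷suc-increasing g-inc , λ { zero → c₀≡b ; (suc i) → g-mono i }

pigeonhole : ∀ n a b → a + b ≤ n → (c : Fin n → Bool) →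
             ∃Increasing a n (Monochromatic c true) ⊎ ∃Increasing b n (Monochromatic c false)
pigeonhole n       zero    b       _           c = inj₁ ((λ ()) , (λ ()) , λ ())
pigeonhole n       (suc a) zero    _           c = inj₂ ((λ ()) , (λ ()) , λ ())
pigeonhole (suc n) (suc a) (suc b) (s≤s a+b≤n) c with c zero in c₀
... | true  = Sum.map (prepend c c₀) (shift c) (pigeonhole n a (suc b) a+b≤n (c ∘ suc))
... | false = Sum.map (shift c) (prepend c c₀)
  (pigeonhole n (suc a) b (subst (_≤ n) (ℕₚ.+-suc a b) a+b≤n) (c ∘ suc))

monochromatic-half : ∀ k (c : Fin (k + k) → Bool) →
                     Σ Bool λ b → ∃Increasing k (k + k) (Monochromatic c b)
monochromatic-half k c = Sum.[ (true ,_) , (false ,_) ]′ (pigeonhole (k + k) k k ℕₚ.≤-refl c)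

Colouring : ℕ → ℕ → Set
Colouring m n = (Fin m → Fin n) → Bool

-- Tuples are functions, so a colouring must be asked to respect ≗.
Extensional : ∀ {m n} → Colouring m n → Set
Extensional c = ∀ {u v} → u ≗ v → c u ≡ c v

restrict : ∀ {m n n′} → Colouring m n → (Fin n′ → Fin n) → Colouring m n′
restrict c h w = c (h ∘ w)

restrict-extensional : ∀ {m n n′} {c : Colouring m n} (h : Fin n′ → Fin n) →
                       Extensional c → Extensional (restrict c h)
restrict-extensional h c-ext u≗v = c-ext (cong h ∘ u≗v)

fromZero : ∀ {m n} → Colouring (suc m) (suc n) → Colouring m n
fromZero c w = c (zero Vector.∷ suc ∘ w)

fromZero-extensional : ∀ {m n} {c : Colouring (suc m) (suc n)} →
                       Extensional c → Extensional (fromZero c)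
fromZero-extensional c-ext u≗v = c-ext (∷-cong refl (cong suc ∘ u≗v))

Homogeneous : ∀ {m n k} → Colouring m n → (Fin k → Fin n) → Set
Homogeneous c h = ∀ {u v} → StrictlyIncreasing u → StrictlyIncreasing v → c (h ∘ u) ≡ c (h ∘ v)

MinHomogeneous : ∀ {m n k} → Colouring (suc m) n → (Fin k → Fin n) → Set
MinHomogeneous c h = ∀ {u v} → StrictlyIncreasing u → StrictlyIncreasing v →
                     u zero ≡ v zero → c (h ∘ u) ≡ c (h ∘ v)

HasRamseyNumbers : ℕ → Set
HasRamseyNumbers m =
  ∀ k → Σ ℕ λ n → (c : Colouring m n) → Extensional c → ∃Increasing k n (Homogeneous c)

minHomogeneous : ∀ {m} → HasRamseyNumbers m → ∀ k → Σ ℕ λ n →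
                 (c : Colouring (suc m) n) → Extensional c → ∃Increasing k n (MinHomogeneous c)
minHomogeneous R zero = zero , λ _ _ → (λ ()) , (λ ()) , λ {u} _ _ _ → contradiction (u zero) Finₚ.¬Fin0
minHomogeneous {m} R (suc k) = suc n₁ , construction
  where
  n′ : ℕ
  n′ = proj₁ (minHomogeneous R k)
  n₁ : ℕ
  n₁ = proj₁ (R n′)
  -- h = 0, 1 + h₁ (h₂ _): a tuple through 0 has the colour fromZero c of its tail, which h₁
  -- makes homogeneous; the tuples avoiding 0 are handled recursively by h₂.
  construction : (c : Colouring (suc m) (suc n₁)) → Extensional c →
                 ∃Increasing (suc k) (suc n₁) (MinHomogeneous c)
  construction c c-ext with proj₂ (R n′) (fromZero c) (fromZero-extensional c-ext)
  ... | h₁ , h₁-inc , h₁-hom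
      with proj₂ (minHomogeneous R k) (restrict c (suc ∘ h₁)) (restrict-extensional (suc ∘ h₁) c-ext)
  ... | h₂ , h₂-inc , h₂-minhom = h , 0∷suc-increasing (∘-increasing h₁-inc h₂-inc) , minhom
    where
    h : Fin (suc k) → Fin (suc n₁)
    h = zero Vector.∷ suc ∘ h₁ ∘ h₂
    via-zero : ∀ u {u′} → u zero ≡ zero → u ∘ suc ≗ suc ∘ u′ → c (h ∘ u) ≡ fromZero c (h₁ ∘ h₂ ∘ u′)
    via-zero u u₀≡0 u≗ = c-ext (∷-cong (cong h u₀≡0) (cong h ∘ u≗))
    via-suc : ∀ u {u′} → u ≗ suc ∘ u′ → c (h ∘ u) ≡ restrict c (suc ∘ h₁) (h₂ ∘ u′)
    via-suc u u≗ = c-ext (cong h ∘ u≗)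
    minhom : MinHomogeneous c h
    minhom {u} {v} u-inc v-inc u₀≡v₀ with zero-or-suc u-inc | zero-or-suc v-inc
    ... | inj₁ (u₀≡0 , u′ , u′-inc , u≗) | inj₁ (v₀≡0 , v′ , v′-inc , v≗) = begin
      c (h ∘ u)                  ≡⟨ via-zero u u₀≡0 u≗ ⟩
      fromZero c (h₁ ∘ h₂ ∘ u′)  ≡⟨ h₁-hom (∘-increasing h₂-inc u′-inc) (∘-increasing h₂-inc v′-inc) ⟩
      fromZero c (h₁ ∘ h₂ ∘ v′)  ≡⟨ via-zero v v₀≡0 v≗ ⟨
      c (h ∘ v)                  ∎
      where open ≡-Reasoning
    ... | inj₂ (u′ , u′-inc , u≗) | inj₂ (v′ , v′-inc , v≗) = begin
      c (h ∘ u)                          ≡⟨ via-suc u u≗ ⟩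
      restrict c (suc ∘ h₁) (h₂ ∘ u′)    ≡⟨ h₂-minhom u′-inc v′-inc u′₀≡v′₀ ⟩
      restrict c (suc ∘ h₁) (h₂ ∘ v′)    ≡⟨ via-suc v v≗ ⟨
      c (h ∘ v)                          ∎
      where
      open ≡-Reasoning
      u′₀≡v′₀ : u′ zero ≡ v′ zero
      u′₀≡v′₀ = Finₚ.suc-injective (trans (sym (u≗ zero)) (trans u₀≡v₀ (v≗ zero)))
    ... | inj₁ (u₀≡0 , _) | inj₂ (_ , _ , v≗) =
      contradiction (trans (sym u₀≡0) (trans u₀≡v₀ (v≗ zero))) λ ()
    ... | inj₂ (_ , _ , u≗) | inj₁ (v₀≡0 , _) =
      contradiction (trans (sym v₀≡0) (trans (sym u₀≡v₀) (u≗ zero))) λ ()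

ramsey : ∀ m → HasRamseyNumbers m
ramsey zero    k = k , λ c c-ext → id , id-increasing , λ _ _ → c-ext λ ()
ramsey (suc m) k = n , construction
  where
  n : ℕ
  n = proj₁ (minHomogeneous (ramsey m) (k + k + m))
  start : Fin (k + k) → Fin (suc m) → Fin (k + k + m)
  start i = (i ↑ˡ m) Vector.∷ ((k + k) ↑ʳ_)
  start-increasing : ∀ i → StrictlyIncreasing (start i)
  start-increasing i = ∷-increasing (↑ˡ<↑ʳ i) (↑ʳ-increasing (k + k))
  construction : (c : Colouring (suc m) n) → Extensional c → ∃Increasing k n (Homogeneous c)
  construction c c-ext with proj₂ (minHomogeneous (ramsey m) (k + k + m)) c c-ext
  ... | h , h-inc , h-minhom with monochromatic-half k (λ i → c (h ∘ start i))
  ... | b , g , g-inc , g-mono =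
    h ∘ g′ , ∘-increasing h-inc g′-inc , λ u-inc v-inc → trans (colour u-inc) (sym (colour v-inc))
    where
    g′ : Fin k → Fin (k + k + m)
    g′ = (_↑ˡ m) ∘ g
    g′-inc : StrictlyIncreasing g′
    g′-inc = ∘-increasing (↑ˡ-increasing m) g-inc
    -- By min-homogeneity a tuple with least element i has the colour of start i.
    colour : ∀ {u} → StrictlyIncreasing u → c (h ∘ g′ ∘ u) ≡ b
    colour {u} u-inc =
      trans (h-minhom (∘-increasing g′-inc u-inc) (start-increasing (g (u zero))) refl) (g-mono (u zero))

ramsey-simultaneous : ∀ {X : Set} (arity : X → ℕ) (xs : List X) k → Σ ℕ λ n →
                      (c : (x : X) → Colouring (arity x) n) → (∀ x → Extensional (c x)) →
                      ∃Increasing k n (λ h → ∀ {x} → x ∈ xs → Homogeneous (c x) h)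
ramsey-simultaneous arity []       k = k , λ _ _ → id , id-increasing , λ ()
ramsey-simultaneous arity (x ∷ xs) k = n , construction
  where
  n′ : ℕ
  n′ = proj₁ (ramsey-simultaneous arity xs k)
  n : ℕ
  n = proj₁ (ramsey (arity x) n′)
  construction : (c : ∀ y → Colouring (arity y) n) → (∀ y → Extensional (c y)) →
                 ∃Increasing k n (λ h → ∀ {y} → y ∈ x ∷ xs → Homogeneous (c y) h)
  construction c c-ext with proj₂ (ramsey (arity x) n′) (c x) (c-ext x)
  ... | h₁ , h₁-inc , h₁-hom
      with proj₂ (ramsey-simultaneous arity xs k) (λ y → restrict (c y) h₁)
                                                  (λ y → restrict-extensional h₁ (c-ext y))
  ... | h₂ , h₂-inc , h₂-hom = h₁ ∘ h₂ , ∘-increasing h₁-inc h₂-inc , λ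
    { (here refl)  u-inc v-inc → h₁-hom (∘-increasing h₂-inc u-inc) (∘-increasing h₂-inc v-inc)
    ; (there y∈xs) → h₂-hom y∈xs }

image-suc : ∀ {m n} {ι : Fin m → Fin n} {I : Subset n} →
            IsImage ι I → IsImage (suc ∘ ι) (false Vec.∷ I)
image-suc ι-img zero    = mk⇔ (λ ()) (λ ())
image-suc ι-img (suc x) = mk⇔
  (λ { (there x∈I) → let (a , ιa≡x) = Equivalence.to (ι-img x) x∈I in a , cong suc ιa≡x })
  (λ (a , eq) → there (Equivalence.from (ι-img x) (a , Finₚ.suc-injective eq)))

image-0∷suc : ∀ {m n} {ι : Fin m → Fin n} {I : Subset n} →
              IsImage ι I → IsImage (zero Vector.∷ suc ∘ ι) (true Vec.∷ I)
image-0∷suc ι-img zero    = mk⇔ (λ _ → zero , refl) (λ _ → here)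
image-0∷suc ι-img (suc x) = mk⇔
  (λ { (there x∈I) → let (a , ιa≡x) = Equivalence.to (ι-img x) x∈I in suc a , cong suc ιa≡x })
  (λ { (suc a , eq) → there (Equivalence.from (ι-img x) (a , Finₚ.suc-injective eq)) })

enumerate : ∀ {n} (I : Subset n) → ∃Increasing ∣ I ∣ n (λ ι → IsImage ι I)
enumerate Vec.[] = (λ ()) , (λ ()) , λ ()
enumerate (true Vec.∷ I) with enumerate I
... | ι , ι-inc , ι-img = zero Vector.∷ suc ∘ ι , 0∷suc-increasing ι-inc , image-0∷suc ι-img
enumerate (false Vec.∷ I) with enumerate I
... | ι , ι-inc , ι-img = suc ∘ ι , ∘-increasing suc-increasing ι-inc , image-suc ι-img

enumerate-sized : ∀ {m n} (I : Subset n) → ∣ I ∣ ≡ m → ∃Increasing m n (λ ι → IsImage ι I)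
enumerate-sized I refl = enumerate I

same-image⇒≤ : ∀ {m m′ n} {ι : Fin m → Fin n} {ι′ : Fin m′ → Fin n} {I : Subset n} →
               StrictlyIncreasing ι → IsImage ι I → IsImage ι′ I → m ≤ m′
same-image⇒≤ {ι = ι} {ι′} ι-inc ι-img ι′-img = Finₚ.injective⇒≤ λ {a} {b} eq →
  increasing⇒injective ι-inc
    (trans (sym (proj₂ (preimage a))) (trans (cong ι′ eq) (proj₂ (preimage b))))
  where
  preimage : ∀ a → ∃ λ a′ → ι′ a′ ≡ ι a
  preimage a = Equivalence.to (ι′-img (ι a)) (Equivalence.from (ι-img (ι a)) (a , refl))

image-size : ∀ {m n} {ι : Fin m → Fin n} {I : Subset n} →
             StrictlyIncreasing ι → IsImage ι I → ∣ I ∣ ≡ m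
image-size {I = I} ι-inc ι-img with enumerate I
... | ι₀ , ι₀-inc , ι₀-img =
  ℕₚ.≤-antisym (same-image⇒≤ ι₀-inc ι₀-img ι-img) (same-image⇒≤ ι-inc ι-img ι₀-img)

-- Rainbow copies with prescribed blocks

anyFunction? : ∀ {m n} {P : (Fin m → Fin n) → Set} → (∀ {f g} → f ≗ g → P f → P g) →
               (∀ f → Dec (P f)) → Dec (∃ P)
anyFunction? {zero}  P-resp P? = map′ (_ ,_) (λ (f , Pf) → P-resp (λ ()) Pf) (P? λ ())
anyFunction? {suc m} P-resp P? = map′
  (λ (y , f , Pf) → y Vector.∷ f , Pf)
  (λ (f , Pf) → f zero , f ∘ suc , P-resp (∷-cong refl λ _ → refl) Pf)
  (any? λ y → anyFunction? (P-resp ∘ ∷-cong refl) (P? ∘ (y Vector.∷_)))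

does-≡⇒ : ∀ {P Q : Set} (P? : Dec P) (Q? : Dec Q) → does P? ≡ does Q? → P → Q
does-≡⇒ P? (yes q) _   _ = q
does-≡⇒ P? (no ¬q) P≡Q p = contradiction (trans (sym (dec-true P? p)) P≡Q) λ ()

module _ {n₁ n₂ K L : ℕ} (G : Bigraph n₁ n₂) (A : Fin K → Subset n₁) (B : Fin L → Subset n₂) where

  Realises : ∀ {p q} → (Fin p → Fin q → Bool) → (Fin p → Fin K) → (Fin q → Fin L) →
             (Fin p → Fin n₁) → (Fin q → Fin n₂) → Set
  Realises e ι κ f g =
    (∀ a → f a Sub.∈ A (ι a)) × (∀ b → g b Sub.∈ B (κ b)) × (∀ a b → edge G (f a) (g b) ≡ e a b)

  CopyOn : ∀ {p q} → (Fin p → Fin q → Bool) → (Fin p → Fin K) → (Fin q → Fin L) → Set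
  CopyOn {p} {q} e ι κ = Σ (Fin p → Fin n₁) λ f → Σ (Fin q → Fin n₂) λ g → Realises e ι κ f g

  realises-resp : ∀ {p q} {e e′ : Fin p → Fin q → Bool} {ι ι′ κ κ′ f f′ g g′} →
                  (∀ a b → e a b ≡ e′ a b) → ι ≗ ι′ → κ ≗ κ′ → f ≗ f′ → g ≗ g′ →
                  Realises e ι κ f g → Realises e′ ι′ κ′ f′ g′
  realises-resp e≗ ι≗ κ≗ f≗ g≗ (f∈ , g∈ , adj) =
    (λ a → subst₂ (λ x i → x Sub.∈ A i) (f≗ a) (ι≗ a) (f∈ a)) ,
    (λ b → subst₂ (λ y j → y Sub.∈ B j) (g≗ b) (κ≗ b) (g∈ b)) ,
    λ a b → trans (cong₂ (edge G) (sym (f≗ a)) (sym (g≗ b))) (trans (adj a b) (e≗ a b))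

  copyOn-resp : ∀ {p q} {e e′ : Fin p → Fin q → Bool} {ι ι′ κ κ′} →
                (∀ a b → e a b ≡ e′ a b) → ι ≗ ι′ → κ ≗ κ′ → CopyOn e ι κ → CopyOn e′ ι′ κ′
  copyOn-resp e≗ ι≗ κ≗ (f , g , r) = f , g , realises-resp e≗ ι≗ κ≗ (λ _ → refl) (λ _ → refl) r

  copyOn? : ∀ {p q} (e : Fin p → Fin q → Bool) ι κ → Dec (CopyOn e ι κ)
  copyOn? e ι κ =
    anyFunction? (λ f≗ (g , r) → g , realises-resp (λ _ _ → refl) ≗-refl ≗-refl f≗ ≗-refl r) λ f →
    anyFunction? (realises-resp (λ _ _ → refl) ≗-refl ≗-refl ≗-refl) λ g →
      all? (λ a → f a ∈? A (ι a)) ×-dec all? (λ b → g b ∈? B (κ b)) ×-dec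
      all? (λ a → all? λ b → edge G (f a) (g b) ≟ᵇ e a b)
    where
    ≗-refl : ∀ {X : Set} {m} {h : Fin m → X} → h ≗ h
    ≗-refl _ = refl

  rainbow⇒copyOn : ∀ {p q} {S : Bigraph p q} (c : RainbowCopy G A B S) →
                   CopyOn (edge S) (RainbowCopy.ι c) (RainbowCopy.κ c)
  rainbow⇒copyOn c =
    RainbowCopy.f c , RainbowCopy.g c , RainbowCopy.f∈ c , RainbowCopy.g∈ c , RainbowCopy.adj c

  copyOn⇒rainbow : ∀ {p q} {S : Bigraph p q} {ι κ} → StrictlyIncreasing ι → StrictlyIncreasing κ →
                   CopyOn (edge S) ι κ → RainbowCopy G A B S
  copyOn⇒rainbow {ι = ι} {κ} ι-inc κ-inc (f , g , f∈ , g∈ , adj) = record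
    { ι = ι ; κ = κ ; ι-inc = ι-inc ; κ-inc = κ-inc ; f = f ; g = g ; f∈ = f∈ ; g∈ = g∈ ; adj = adj }

  CopyInvariant : ∀ {p q} → (Fin p → Fin q → Bool) → Set
  CopyInvariant e = ∀ {ι κ ι′ κ′} → StrictlyIncreasing ι → StrictlyIncreasing κ →
                    StrictlyIncreasing ι′ → StrictlyIncreasing κ′ → CopyOn e ι κ → CopyOn e ι′ κ′

  trace-empty-or-full : ∀ {p q} (S : Bigraph p q) → CopyInvariant (edge S) →
                        (∀ I J → ¬ InTrace G A B S I J)
                        ⊎ (∀ I J → InTrace G A B S I J ⇔ (∣ I ∣ ≡ p × ∣ J ∣ ≡ q))
  trace-empty-or-full {p} {q} S invariant with p ℕ.≤? K | q ℕ.≤? L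
  ... | no p≰K | _      = inj₁ λ _ _ (c , _) → p≰K (increasing⇒≤ (RainbowCopy.ι-inc c))
  ... | yes _  | no q≰L = inj₁ λ _ _ (c , _) → q≰L (increasing⇒≤ (RainbowCopy.κ-inc c))
  ... | yes p≤K | yes q≤L with copyOn? (edge S) (λ a → inject≤ a p≤K) (λ b → inject≤ b q≤L)
  ...   | no ¬c₀ = inj₁ λ _ _ (c , _) → ¬c₀
          (invariant (RainbowCopy.ι-inc c) (RainbowCopy.κ-inc c)
                     (inject≤-increasing p≤K) (inject≤-increasing q≤L) (rainbow⇒copyOn c))
  ...   | yes c₀ = inj₂ λ I J → mk⇔
          (λ (c , I-img , J-img) →
            image-size (RainbowCopy.ι-inc c) I-img , image-size (RainbowCopy.κ-inc c) J-img)
          λ (∣I∣≡p , ∣J∣≡q) →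
            let (ι , ι-inc , I-img) = enumerate-sized I ∣I∣≡p
                (κ , κ-inc , J-img) = enumerate-sized J ∣J∣≡q
            in copyOn⇒rainbow ι-inc κ-inc
                 (invariant (inject≤-increasing p≤K) (inject≤-increasing q≤L) ι-inc κ-inc c₀) ,
               I-img , J-img

  supportUniform : ∀ τ → (∀ {p q} (S : Bigraph p q) → p + q ≤ τ → CopyInvariant (edge S)) →
                   SupportUniform τ G A B
  supportUniform τ invariant p q S _ p+q≤τ = trace-empty-or-full S (invariant S p+q≤τ)

-- An ordered bigraph on Fin p ⊎ Fin q, as an adjacency matrix, so that
-- the shapes of bounded size form a list with exact membership.
Shape : Set
Shape = Σ ℕ λ p → Σ ℕ λ q → Vec (Vec Bool q) p

arity : Shape → ℕ
arity (p , q , _) = p + q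

adjacency : ∀ {p q} → Vec (Vec Bool q) p → Fin p → Fin q → Bool
adjacency E a b = lookup (lookup E a) b

matrix : ∀ {p q} → Bigraph p q → Vec (Vec Bool q) p
matrix S = tabulate (tabulate ∘ edge S)

shape : ∀ {p q} → Bigraph p q → Shape
shape {p} {q} S = p , q , matrix S

adjacency-matrix : ∀ {p q} (S : Bigraph p q) a b → adjacency (matrix S) a b ≡ edge S a b
adjacency-matrix S a b =
  trans (cong (λ row → lookup row b) (lookup∘tabulate _ a)) (lookup∘tabulate _ b)

allVecs : ∀ {X : Set} → List X → ∀ n → List (Vec X n)
allVecs xs zero    = Vec.[] ∷ []
allVecs xs (suc n) = cartesianProductWith Vec._∷_ xs (allVecs xs n)

∈-allVecs : ∀ {X : Set} {xs : List X} → (∀ x → x ∈ xs) → ∀ {n} (v : Vec X n) → v ∈ allVecs xs n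
∈-allVecs xs-complete Vec.[]       = here refl
∈-allVecs xs-complete (x Vec.∷ v) =
  ∈-cartesianProductWith⁺ Vec._∷_ (xs-complete x) (∈-allVecs xs-complete v)

∈-bools : ∀ b → b ∈ true ∷ false ∷ []
∈-bools true  = here refl
∈-bools false = there (here refl)

shapesOfSize : ℕ → ℕ → List Shape
shapesOfSize p q = List.map (λ E → p , q , E) (allVecs (allVecs (true ∷ false ∷ []) q) p)

shapes : ℕ → List Shape
shapes τ = concatMap (uncurry shapesOfSize) (cartesianProduct (upTo (suc τ)) (upTo (suc τ)))

shape∈shapes : ∀ {τ p q} (S : Bigraph p q) → p + q ≤ τ → shape S ∈ shapes τ
shape∈shapes {p = p} {q} S p+q≤τ = ∈-concat⁺′
  (∈-map⁺ (λ E → p , q , E) (∈-allVecs (∈-allVecs ∈-bools) (matrix S)))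
  (∈-map⁺ (uncurry shapesOfSize) (∈-cartesianProduct⁺
    (∈-upTo⁺ (s≤s (ℕₚ.m+n≤o⇒m≤o p p+q≤τ))) (∈-upTo⁺ (s≤s (ℕₚ.m+n≤o⇒n≤o p p+q≤τ)))))

module _ {n₁ n₂ K : ℕ} (G : Bigraph n₁ n₂) (A : Fin K → Subset n₁) (B : Fin K → Subset n₂) where

  copyColouring : (x : Shape) → Colouring (arity x) K
  copyColouring (p , q , E) w = does (copyOn? G A B (adjacency E) (w ∘ (_↑ˡ q)) (w ∘ (p ↑ʳ_)))

  copyColouring-extensional : ∀ x → Extensional (copyColouring x)
  copyColouring-extensional (p , q , E) {u} {v} u≗v = does-⇔
    (mk⇔ (transport u v u≗v) (transport v u (λ i → sym (u≗v i))))
    (copyOn? G A B _ _ _) (copyOn? G A B _ _ _)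
    where
    transport : ∀ u v → u ≗ v → CopyOn G A B (adjacency E) (u ∘ (_↑ˡ q)) (u ∘ (p ↑ʳ_)) →
                                CopyOn G A B (adjacency E) (v ∘ (_↑ˡ q)) (v ∘ (p ↑ʳ_))
    transport _ _ u≗v = copyOn-resp G A B (λ _ _ → refl) (u≗v ∘ (_↑ˡ q)) (u≗v ∘ (p ↑ʳ_))

  halves-invariant : ∀ {k} (h : Fin (k + k) → Fin K) {p q} (S : Bigraph p q) →
                     Homogeneous (copyColouring (shape S)) h →
                     CopyInvariant G (A ∘ h ∘ (_↑ˡ k)) (B ∘ h ∘ (k ↑ʳ_)) (edge S)
  halves-invariant {k} h {p} {q} S hom {ι} {κ} {ι′} {κ′} ι-inc κ-inc ι′-inc κ′-inc =
    does-≡⇒ (copyOn? G A′ B′ (edge S) ι κ) (copyOn? G A′ B′ (edge S) ι′ κ′) (begin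
      does (copyOn? G A′ B′ (edge S) ι κ)     ≡⟨ colour-of-join ι κ ⟩
      copyColouring (shape S) (h ∘ join ι κ)   ≡⟨ hom (join-increasing ι-inc κ-inc)
                                                     (join-increasing ι′-inc κ′-inc) ⟩
      copyColouring (shape S) (h ∘ join ι′ κ′) ≡⟨ colour-of-join ι′ κ′ ⟨
      does (copyOn? G A′ B′ (edge S) ι′ κ′)   ∎)
    where
    open ≡-Reasoning
    A′ : Fin k → Subset n₁
    A′ = A ∘ h ∘ (_↑ˡ k)
    B′ : Fin k → Subset n₂
    B′ = B ∘ h ∘ (k ↑ʳ_)
    join : (Fin p → Fin k) → (Fin q → Fin k) → Fin (p + q) → Fin (k + k)
    join ι κ = (_↑ˡ k) ∘ ι ++ (k ↑ʳ_) ∘ κ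
    join-left : ∀ ι κ a → join ι κ (a ↑ˡ q) ≡ ι a ↑ˡ k
    join-left ι κ = lookup-++ˡ ((_↑ˡ k) ∘ ι) ((k ↑ʳ_) ∘ κ)
    join-right : ∀ ι κ b → join ι κ (p ↑ʳ b) ≡ k ↑ʳ κ b
    join-right ι κ = lookup-++ʳ ((_↑ˡ k) ∘ ι) ((k ↑ʳ_) ∘ κ)
    join-increasing : ∀ {ι κ} → StrictlyIncreasing ι → StrictlyIncreasing κ →
                      StrictlyIncreasing (join ι κ)
    join-increasing {ι} {κ} ι-inc κ-inc = ++-increasing
      (∘-increasing (↑ˡ-increasing k) ι-inc) (∘-increasing (↑ʳ-increasing k) κ-inc)
      (λ a b → ↑ˡ<↑ʳ (ι a) (κ b))
    colour-of-join : ∀ ι κ →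
                     does (copyOn? G A′ B′ (edge S) ι κ) ≡ copyColouring (shape S) (h ∘ join ι κ)
    colour-of-join ι κ = does-⇔
      (mk⇔ (copyOn-resp G A B (λ a b → sym (adjacency-matrix S a b))
                         (λ a → cong h (sym (join-left ι κ a))) (λ b → cong h (sym (join-right ι κ b))))
           (copyOn-resp G A B (adjacency-matrix S)
                         (λ a → cong h (join-left ι κ a)) (λ b → cong h (join-right ι κ b))))
      (copyOn? G A′ B′ (edge S) ι κ) (copyOn? G A B _ _ _)

  halves-supportUniform : ∀ {k} τ (h : Fin (k + k) → Fin K) →
                          (∀ {x} → x ∈ shapes τ → Homogeneous (copyColouring x) h) →
                          SupportUniform τ G (A ∘ h ∘ (_↑ˡ k)) (B ∘ h ∘ (k ↑ʳ_))
  halves-supportUniform τ h homogeneous =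
    supportUniform G _ _ τ λ S p+q≤τ → halves-invariant h S (homogeneous (shape∈shapes S p+q≤τ))

mainTheorem8 : (k τ : ℕ) → Σ ℕ λ K →
    ∀ (n₁ n₂ : ℕ) (G : Bigraph n₁ n₂) (A : Fin K → Subset n₁) (B : Fin K → Subset n₂) →
      IsParade A B →
      Σ (Fin k → Fin K) λ r → Σ (Fin k → Fin K) λ s →
        StrictlyIncreasing r × StrictlyIncreasing s × SupportUniform τ G (A ∘ r) (B ∘ s)
mainTheorem8 k τ with ramsey-simultaneous arity (shapes τ) (k + k)
... | K , homogeneous-subsequence = K , λ n₁ n₂ G A B _ →
  let (h , h-inc , h-hom) =
        homogeneous-subsequence (copyColouring G A B) (copyColouring-extensional G A B)
  in h ∘ (_↑ˡ k) , h ∘ (k ↑ʳ_) ,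
     ∘-increasing h-inc (↑ˡ-increasing k) , ∘-increasing h-inc (↑ʳ-increasing k) ,
     halves-supportUniform G A B τ h h-hom
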